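{- Let $k\ge 4$ be an integer. Let $H$ be a $(2k,k-1)$-bigraph with parts $A,B$ such that there exist $X\subseteq A$ and $\tilde E\subseteq E(H)$ with $|\tilde E|\le 1$ and $|X|-|N_{H-\tilde E}(X)|=2$. Let $H'$ be a $(2k,k-1)$-bigraph (on the same parts) formed from $H$ by adding two matchings and removing two matchings. If $H'$ contains a matching of size 2 from $X$ to $B\setminus N_{H-\tilde E}(X)$, then $H'$ has a 1-factor.
   Context: A bigraph is a bipartite graph with parts $A$ and $B$ such that $|A|=|B|$; an $(s,t)$-bigraph is a bigraph with $|A|=|B|=s$ and minimum degree at least $t$. $N_F(X)$ denotes the set of vertices adjacent in $F$ to some vertex of $X$. -}

module Defs where

open import Data.Nat using (ℕ; _≤_; _+_; _*_)
open import Data.Bool using (Bool; true; false; _∧_; not)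
open import Data.Fin using (Fin)
open import Data.Fin.Subset using (Subset; ∣_∣; _∈_; _∉_)
open import Data.Vec using (tabulate; lookup)
open import Data.List using (allFin; map)
open import Data.Nat.ListAction using (sum)
open import Data.Bool.ListAction using (any)
open import Data.Product using (Σ; ∃; _×_; _,_)
open import Relation.Binary.PropositionalEquality using (_≡_; _≢_)
open import Relation.Nullary using (¬_)
open import Data.Fin.Permutation using (Permutation′; _⟨$⟩ʳ_)

-- A bigraph with parts A = B-index set Fin n on each side:
-- G a b ≡ true  iff  a ∈ A is adjacent to b ∈ B.
BiGraph : ℕ → Set
BiGraph n = Fin n → Fin n → Bool

EdgeSet : ℕ → Set
EdgeSet = BiGraph

degA : ∀ {n} → BiGraph n → Fin n → ℕ
degA G a = ∣ tabulate (λ b → G a b) ∣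

degB : ∀ {n} → BiGraph n → Fin n → ℕ
degB G b = ∣ tabulate (λ a → G a b) ∣

IsBigraph : (s t : ℕ) → BiGraph s → Set
IsBigraph s t G = (∀ a → t ≤ degA G a) × (∀ b → t ≤ degB G b)

numEdges : ∀ {n} → EdgeSet n → ℕ
numEdges {n} E = sum (map (λ a → degA E a) (allFin n))

_⊆E_ : ∀ {n} → EdgeSet n → EdgeSet n → Set
E ⊆E F = ∀ a b → E a b ≡ true → F a b ≡ true

_-E_ : ∀ {n} → BiGraph n → EdgeSet n → BiGraph n
(H -E E) a b = H a b ∧ not (E a b)

nbr : ∀ {n} → BiGraph n → Subset n → Subset n
nbr {n} F X = tabulate (λ b → any (λ a → lookup X a ∧ F a b) (allFin n))

IsMatching : ∀ {n} → EdgeSet n → Set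
IsMatching M =
  (∀ a b b′ → M a b ≡ true → M a b′ ≡ true → b ≡ b′) ×
  (∀ a a′ b → M a b ≡ true → M a′ b ≡ true → a ≡ a′)

FormedBy : ∀ {n} → BiGraph n → BiGraph n → Set
FormedBy {n} H H′ =
  Σ (EdgeSet n) λ M₁ → Σ (EdgeSet n) λ M₂ → Σ (EdgeSet n) λ M₃ → Σ (EdgeSet n) λ M₄ →
    IsMatching M₁ × IsMatching M₂ × IsMatching M₃ × IsMatching M₄ ×
    (∀ a b → H′ a b ≡ true →
        (H a b ≡ true × M₃ a b ≡ false × M₄ a b ≡ false) Data.Sum.⊎ (M₁ a b ≡ true Data.Sum.⊎ M₂ a b ≡ true)) ×
    (∀ a b → (H a b ≡ true × M₃ a b ≡ false × M₄ a b ≡ false) Data.Sum.⊎ (M₁ a b ≡ true Data.Sum.⊎ M₂ a b ≡ true) →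
        H′ a b ≡ true)
  where import Data.Sum

Matching2 : ∀ {n} → BiGraph n → Subset n → Subset n → Set
Matching2 {n} F X Y =
  Σ (Fin n) λ a₁ → Σ (Fin n) λ b₁ → Σ (Fin n) λ a₂ → Σ (Fin n) λ b₂ →
    a₁ ≢ a₂ × b₁ ≢ b₂ ×
    a₁ ∈ X × a₂ ∈ X × b₁ ∈ Y × b₂ ∈ Y ×
    F a₁ b₁ ≡ true × F a₂ b₂ ≡ true

compl : ∀ {n} → Subset n → Subset n
compl = Data.Fin.Subset.∁
  where import Data.Fin.Subset

HasOneFactor : ∀ {n} → BiGraph n → Set
HasOneFactor {n} F = Σ (Permutation′ n) λ π → ∀ a → F a (π ⟨$⟩ʳ a) ≡ true

{-# OPTIONS --safe #-}
module Submission where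

-- By Hall's theorem it suffices that |N_{H′}(S)| ≥ |S| for all S ⊆ A. Write d = k − 1 and
-- N = N_{H−Ẽ}(X); minimum degree d settles |S| ≤ d and |S| ≥ d + 3. As Ẽ has at most one edge,
-- some vertex of X has all its H-neighbours in N and some vertex of B ∖ N all its H-neighbours
-- in A ∖ X, so |N|, |A ∖ X| ≥ d, and |X| = |N| + 2 forces |N| = |A ∖ X| = d. The same degree
-- count makes H complete between X and N, and between A ∖ X and B ∖ N, up to one missing edge
-- each. H′ lacks an edge of H only inside the two removed matchings, so nonempty U ⊆ S and
-- V ⊆ B ∖ N_{H′}(S) within one of these blocks satisfy |U| + |V| ≤ 4. For |S| ∈ {d + 1, d + 2}
-- this bounds what N_{H′}(S) misses, and when S ⊆ X the two edges of H′ from X to B ∖ N supply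
-- the last two neighbours.

open import Defs
open import Data.Nat using (ℕ; _≤_; _+_; _*_; _∸_)
open import Data.Fin.Subset using (Subset; ∣_∣)
open import Relation.Binary.PropositionalEquality using (_≡_)

open import Data.Bool using (Bool; true; false; _∧_; _∨_; not; if_then_else_)
open import Data.Bool.Properties using (∧-comm; not-¬; ¬-not; T-≡) renaming (_≟_ to _≟ᵇ_)
open import Data.Bool.ListAction using (any)
open import Data.Empty using (⊥-elim)
open import Data.Fin using (Fin; zero; suc; _≟_; punchOut)
import Data.Fin.Properties as Fin
open import Data.Fin.Subset using (_∈_)
open import Data.Fin.Subset.Properties using (anySubset?)
open import Data.Fin.Permutation using (permutation)
open import Data.List using (allFin; map; tabulate)
open import Data.List.Properties using (map-tabulate)
open import Data.List.Membership.Propositional using (lose)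
open import Data.List.Membership.Propositional.Properties using (∈-allFin)
open import Data.List.Relation.Unary.Any using (satisfied)
open import Data.List.Relation.Unary.Any.Properties using (any⁺; any⁻)
open import Data.Nat using (zero; suc; _<_; z≤n; s≤s)
open import Data.Nat.ListAction using (sum)
open import Data.Nat.Properties hiding (_≟_)
open import Algebra.Properties.CommutativeSemigroup +-commutativeSemigroup using (interchange)
open import Data.Product using (∃; _×_; _,_; proj₁; proj₂; swap)
open import Data.Sum using (_⊎_; inj₁; inj₂)
import Data.Vec as Vec
open import Data.Vec.Properties using (lookup∘tabulate; tabulate∘lookup; lookup-map; []=⇒lookup)
open import Function using (_∘_; _∘₂_; Injective)
open import Function.Bundles using (module Equivalence)
open import Relation.Binary.PropositionalEquality
  using (refl; sym; trans; cong; cong₂; subst; _≢_; module ≡-Reasoning)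
open import Relation.Nullary using (¬_; Dec; yes; no; does)
open import Relation.Nullary.Decidable using (dec-true; _×-dec_; _→-dec_)

private
  variable
    n d : ℕ
    p q : Bool
    a a′ b b′ x y : Fin n
    e f g P Q R S U V : Fin n → Bool
    E F G H M₃ M₄ : BiGraph n

true-or-false : ∀ p → p ≡ true ⊎ p ≡ false
true-or-false true  = inj₁ refl
true-or-false false = inj₂ refl

∧-intro : p ≡ true → q ≡ true → p ∧ q ≡ true
∧-intro refl refl = refl

∧-elim : p ∧ q ≡ true → p ≡ true × q ≡ true
∧-elim {true} {true} _ = refl , refl

∨-introˡ : p ≡ true → p ∨ q ≡ true
∨-introˡ refl = refl

∨-introʳ : q ≡ true → p ∨ q ≡ true
∨-introʳ {p = true}  _  = refl
∨-introʳ {p = false} eq = eq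

∨-elim : p ∨ q ≡ true → p ≡ true ⊎ q ≡ true
∨-elim {true}  _  = inj₁ refl
∨-elim {false} eq = inj₂ eq

not≡true : not p ≡ true → p ≡ false
not≡true {false} _ = refl

not≡false : not p ≡ false → p ≡ true
not≡false {true} _ = refl

∧-not-intro : p ≡ true → q ≡ false → p ∧ not q ≡ true
∧-not-intro p≡true q≡false = ∧-intro p≡true (cong not q≡false)

∧-not-elim : p ∧ not q ≡ true → p ≡ true × q ≡ false
∧-not-elim p∧¬q = let p≡true , ¬q = ∧-elim p∧¬q in p≡true , not≡true ¬q

-- Subsets of Fin n as Boolean predicates

infixr 7 _∩_
infixr 6 _∪_ _─_
infix  4 _⊆_

∁ : (Fin n → Bool) → Fin n → Bool
∁ f x = not (f x)

_∩_ _∪_ _─_ : (Fin n → Bool) → (Fin n → Bool) → Fin n → Bool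
(f ∩ g) x = f x ∧ g x
(f ∪ g) x = f x ∨ g x
f ─ g     = f ∩ ∁ g

_⊆_ : (Fin n → Bool) → (Fin n → Bool) → Set
f ⊆ g = ∀ x → f x ≡ true → g x ≡ true

-- ⁅_⁆ and N are opaque so that unification reads their arguments off a membership proof.
opaque
  ⁅_⁆ : Fin n → Fin n → Bool
  ⁅ a ⁆ x = does (x ≟ a)

  x∈⁅x⁆ : ∀ (a : Fin n) → ⁅ a ⁆ a ≡ true
  x∈⁅x⁆ a = dec-true (a ≟ a) refl

  x∈⁅y⁆⇒x≡y : ⁅ a ⁆ x ≡ true → x ≡ a
  x∈⁅y⁆⇒x≡y {a = a} {x} x∈⁅a⁆ with x ≟ a
  ... | yes x≡a = x≡a
  ... | no  _   = ⊥-elim (not-¬ x∈⁅a⁆ refl)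

⁅⁆-unique : ⁅ a ⁆ x ≡ true → ⁅ a ⁆ y ≡ true → x ≡ y
⁅⁆-unique x∈⁅a⁆ y∈⁅a⁆ = trans (x∈⁅y⁆⇒x≡y x∈⁅a⁆) (sym (x∈⁅y⁆⇒x≡y y∈⁅a⁆))

bit : Bool → ℕ
bit false = 0
bit true  = 1

count : (Fin n → Bool) → ℕ
count {zero}  f = 0
count {suc n} f = bit (f zero) + count (f ∘ suc)

count-cong : (∀ x → f x ≡ g x) → count f ≡ count g
count-cong {zero}  _  = refl
count-cong {suc n} eq = cong₂ _+_ (cong bit (eq zero)) (count-cong (eq ∘ suc))

count-mono : f ⊆ g → count f ≤ count g
count-mono {zero}  _           = z≤n
count-mono {suc n} {f} {g} f⊆g = +-mono-≤ (bit-mono (f⊆g zero)) (count-mono (f⊆g ∘ suc))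
  where
  bit-mono : (f zero ≡ true → g zero ≡ true) → bit (f zero) ≤ bit (g zero)
  bit-mono i with f zero
  ... | false = z≤n
  ... | true  rewrite i refl = ≤-refl

count-split : ∀ (f g : Fin n → Bool) → count f ≡ count (f ∩ g) + count (f ─ g)
count-split {zero}  f g = refl
count-split {suc n} f g = trans
  (cong₂ _+_ (bit-split (f zero) (g zero)) (count-split (f ∘ suc) (g ∘ suc)))
  (interchange (bit (f zero ∧ g zero)) (bit (f zero ∧ not (g zero)))
               (count ((f ∩ g) ∘ suc)) (count ((f ─ g) ∘ suc)))
  where
  bit-split : ∀ p q → bit p ≡ bit (p ∧ q) + bit (p ∧ not q)
  bit-split true  true  = refl
  bit-split true  false = refl
  bit-split false _     = refl

count-∪ : ∀ (f g : Fin n → Bool) → count (f ∪ g) ≤ count f + count g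
count-∪ {zero}  f g = z≤n
count-∪ {suc n} f g = ≤-trans
  (+-mono-≤ (bit-∨ (f zero) (g zero)) (count-∪ (f ∘ suc) (g ∘ suc)))
  (≤-reflexive (interchange (bit (f zero)) (bit (g zero)) (count (f ∘ suc)) (count (g ∘ suc))))
  where
  bit-∨ : ∀ p q → bit (p ∨ q) ≤ bit p + bit q
  bit-∨ true  _ = s≤s z≤n
  bit-∨ false _ = ≤-refl

count-∁ : ∀ (f : Fin n → Bool) → count f + count (∁ f) ≡ n
count-∁ {zero}  f = refl
count-∁ {suc n} f = trans
  (interchange (bit (f zero)) (count (f ∘ suc)) (bit (not (f zero))) (count (∁ f ∘ suc)))
  (cong₂ _+_ (bit-∁ (f zero)) (count-∁ (f ∘ suc)))
  where
  bit-∁ : ∀ p → bit p + bit (not p) ≡ 1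
  bit-∁ true  = refl
  bit-∁ false = refl

count-∩-comm : ∀ (f g : Fin n → Bool) → count (f ∩ g) ≡ count (g ∩ f)
count-∩-comm f g = count-cong (λ x → ∧-comm (f x) (g x))

count-∪-disjoint : f ⊆ ∁ g → count f + count g ≤ count (f ∪ g)
count-∪-disjoint {f = f} {g = g} disjoint = begin
  count f + count g                         ≤⟨ +-mono-≤ (count-mono f⊆) (count-mono g⊆) ⟩
  count ((f ∪ g) ─ g) + count ((f ∪ g) ∩ g) ≡⟨ +-comm (count ((f ∪ g) ─ g)) _ ⟩
  count ((f ∪ g) ∩ g) + count ((f ∪ g) ─ g) ≡⟨ count-split (f ∪ g) g ⟨
  count (f ∪ g)                             ∎
  where
  open ≤-Reasoning
  f⊆ : f ⊆ (f ∪ g) ─ g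
  f⊆ x fx = ∧-intro (∨-introˡ fx) (disjoint x fx)
  g⊆ : g ⊆ (f ∪ g) ∩ g
  g⊆ _ gx = ∧-intro (∨-introʳ gx) gx

1≤count : ∀ f → f x ≡ true → 1 ≤ count f
1≤count {x = zero}  f fx rewrite fx = s≤s z≤n
1≤count {x = suc x} f fx = ≤-trans (1≤count (f ∘ suc) fx) (m≤n+m _ (bit (f zero)))

2≤count : ∀ f → f x ≡ true → f y ≡ true → x ≢ y → 2 ≤ count f
2≤count {x = x} {y = y} f fx fy x≢y = subst (2 ≤_) (sym (count-split f ⁅ x ⁆))
  (+-mono-≤ (1≤count (f ∩ ⁅ x ⁆) (∧-intro fx (x∈⁅x⁆ x)))
            (1≤count (f ─ ⁅ x ⁆) (∧-not-intro fy (¬-not (x≢y ∘ sym ∘ x∈⁅y⁆⇒x≡y)))))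

0<count⇒∃ : 0 < count f → ∃ λ x → f x ≡ true
0<count⇒∃ {suc n} {f} pos with f zero in f0
... | true  = zero , f0
... | false = let x , fx = 0<count⇒∃ {f = f ∘ suc} pos in suc x , fx

count≡0 : (∀ x → f x ≡ false) → count f ≡ 0
count≡0 {zero}  _    = refl
count≡0 {suc n} none rewrite none zero = count≡0 (none ∘ suc)

count≤1 : (∀ {x y} → f x ≡ true → f y ≡ true → x ≡ y) → count f ≤ 1
count≤1 {zero}  _ = z≤n
count≤1 {suc n} {f} unique with f zero in f0
... | true  = s≤s (≤-reflexive (count≡0 {f = f ∘ suc} λ x → ¬-not (Fin.0≢1+n ∘ unique f0)))
... | false = count≤1 (λ fx fy → Fin.suc-injective (unique fx fy))

count≤1⇒unique : count f ≤ 1 → f x ≡ true → f y ≡ true → x ≡ y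
count≤1⇒unique {x = x} {y = y} ≤1 fx fy with x ≟ y
... | yes x≡y = x≡y
... | no  x≢y = ⊥-elim (≤⇒≯ ≤1 (2≤count _ fx fy x≢y))

count<⇒∃─ : count g < count f → ∃ λ x → f x ≡ true × g x ≡ false
count<⇒∃─ {g = g} {f = f} g<f = let x , x∈f─g = 0<count⇒∃ f─g>0 in x , ∧-not-elim x∈f─g
  where
  open ≤-Reasoning
  f∩g⊆g : f ∩ g ⊆ g
  f∩g⊆g _ = proj₂ ∘ ∧-elim
  f─g>0 : 0 < count (f ─ g)
  f─g>0 = +-cancelˡ-< (count g) 0 _ (begin-strict
    count g + 0                   ≡⟨ +-identityʳ _ ⟩
    count g                       <⟨ g<f ⟩
    count f                       ≡⟨ count-split f g ⟩
    count (f ∩ g) + count (f ─ g) ≤⟨ +-monoˡ-≤ _ (count-mono f∩g⊆g) ⟩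
    count g + count (f ─ g)       ∎)

count-─< : S ⊆ P → 0 < count S → count (P ─ S) < count P
count-─< {S = S} {P = P} S⊆P S>0 = begin-strict
  count (P ─ S)                 <⟨ +-monoˡ-≤ (count (P ─ S)) (≤-trans S>0 (count-mono S⊆P∩S)) ⟩
  count (P ∩ S) + count (P ─ S) ≡⟨ count-split P S ⟨
  count P                       ∎
  where
  open ≤-Reasoning
  S⊆P∩S : S ⊆ P ∩ S
  S⊆P∩S x sx = ∧-intro (S⊆P x sx) sx

-- Neighbourhoods and Hall's theorem

transpose : BiGraph n → BiGraph n
transpose G a b = G b a

opaque
  N : BiGraph n → (Fin n → Bool) → Fin n → Bool
  N {n} G S b = any (λ a → S a ∧ G a b) (allFin n)

  N⁺ : S a ≡ true → G a b ≡ true → N G S b ≡ true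
  N⁺ {S = S} {a = a} {G = G} {b = b} sa gab = Equivalence.to T-≡
    (any⁺ (λ a → S a ∧ G a b) (lose (∈-allFin a) (Equivalence.from T-≡ (∧-intro sa gab))))

  N⁻ : N G S b ≡ true → ∃ λ a → S a ≡ true × G a b ≡ true
  N⁻ {n} {G = G} {S = S} {b = b} b∈N =
    let a , sa∧gab = satisfied (any⁻ (λ a → S a ∧ G a b) (allFin n) (Equivalence.from T-≡ b∈N))
    in a , ∧-elim (Equivalence.to T-≡ sa∧gab)

N-mono : ∀ G → U ⊆ V → N G U ⊆ N G V
N-mono G U⊆V b b∈N = let a , ua , gab = N⁻ {G = G} b∈N in N⁺ (U⊆V a ua) gab

N-∁ : S a ≡ true → N G S b ≡ false → G a b ≡ false
N-∁ sa b∉N = ¬-not λ gab → not-¬ (N⁺ sa gab) b∉N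

HallCondition : BiGraph n → (Fin n → Bool) → Set
HallCondition G P = ∀ S → S ⊆ P → count S ≤ count (N G S)

record Matching {n : ℕ} (G : BiGraph n) (P : Fin n → Bool) : Set where
  field
    partner   : Fin n → Fin n
    edge      : ∀ {a} → P a ≡ true → G a (partner a) ≡ true
    injective : ∀ {a a′} → P a ≡ true → P a′ ≡ true → partner a ≡ partner a′ → a ≡ a′

_-ᴮ_ : BiGraph n → (Fin n → Bool) → BiGraph n
(G -ᴮ R) a b = G a b ∧ not (R b)

N-⊆-∪ : ∀ G R → N G U ⊆ N (G -ᴮ R) U ∪ R
N-⊆-∪ G R b b∈N with true-or-false (R b)
... | inj₁ rb = ∨-introʳ rb
... | inj₂ rb = let a , ua , gab = N⁻ {G = G} b∈N in
  ∨-introˡ (N⁺ {G = G -ᴮ R} ua (∧-not-intro gab rb))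

Matching-join : S ⊆ P → (m : Matching G S) →
                (∀ {a} → S a ≡ true → R (Matching.partner m a) ≡ true) →
                Matching (G -ᴮ R) (P ─ S) → Matching G P
Matching-join {S = S} {P = P} {G = G} {R = R} S⊆P m₁ m₁↦R m₂ =
  record { partner = partner ; edge = edge ; injective = injective }
  where
  module M₁ = Matching m₁
  module M₂ = Matching m₂

  partner : Fin _ → Fin _
  partner a = if S a then M₁.partner a else M₂.partner a

  rest : P a ≡ true → S a ≡ false → (P ─ S) a ≡ true
  rest = ∧-not-intro

  M₂↦∁R : P a ≡ true → S a ≡ false → R (M₂.partner a) ≡ false
  M₂↦∁R pa sa = proj₂ (∧-not-elim (M₂.edge (rest pa sa)))

  edge : P a ≡ true → G a (partner a) ≡ true
  edge {a} pa with S a in sa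
  ... | true  = M₁.edge sa
  ... | false = proj₁ (∧-not-elim (M₂.edge (rest pa sa)))

  injective : P a ≡ true → P a′ ≡ true → partner a ≡ partner a′ → a ≡ a′
  injective {a} {a′} pa pa′ same with S a in sa | S a′ in sa′
  ... | true  | true  = M₁.injective sa sa′ same
  ... | false | false = M₂.injective (rest pa sa) (rest pa′ sa′) same
  ... | true  | false = ⊥-elim (not-¬ (subst (λ b → R b ≡ true) same (m₁↦R sa)) (M₂↦∁R pa′ sa′))
  ... | false | true  =
    ⊥-elim (not-¬ (subst (λ b → R b ≡ true) (sym same) (m₁↦R sa′)) (M₂↦∁R pa sa))

Tight : BiGraph n → (P S : Fin n → Bool) → Set
Tight G P S = S ⊆ P × 0 < count S × count S < count P × count (N G S) ≤ count S

_⊆?_ : ∀ (S P : Fin n → Bool) → Dec (S ⊆ P)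
S ⊆? P = Fin.all? λ x → (S x ≟ᵇ true) →-dec (P x ≟ᵇ true)

tight? : ∀ (G : BiGraph n) P → Dec (∃ λ v → Tight G P (Vec.lookup v))
tight? G P = anySubset? λ v → let S = Vec.lookup v in
  S ⊆? P ×-dec 0 <? count S ×-dec count S <? count P ×-dec count (N G S) ≤? count S

Tight-cong : (∀ x → S x ≡ U x) → Tight G P S → Tight G P U
Tight-cong {S = S} {U = U} {G = G} S≗U (S⊆P , S>0 , S<P , NS≤S) =
  (λ x ux → S⊆P x (U⊆S x ux)) , subst (0 <_) |S|≡|U| S>0 , subst (_< _) |S|≡|U| S<P ,
  ≤-trans (count-mono (N-mono G U⊆S)) (≤-trans NS≤S (≤-reflexive |S|≡|U|))
  where
  U⊆S : U ⊆ S
  U⊆S x ux = trans (S≗U x) ux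
  |S|≡|U| : count S ≡ count U
  |S|≡|U| = count-cong S≗U

HallBelow : (Fin n → Bool) → Set
HallBelow {n} P = ∀ {G : BiGraph n} {Q} → count Q < count P → HallCondition G Q → Matching G Q

hall-tight : HallBelow P → Tight G P S → HallCondition G P → Matching G P
hall-tight {P = P} {G = G} {S = S} ih (S⊆P , S>0 , S<P , NS≤S) hall-P =
  Matching-join S⊆P m₁ (λ sa → N⁺ sa (Matching.edge m₁ sa)) m₂
  where
  NS : Fin _ → Bool
  NS = N G S

  m₁ : Matching G S
  m₁ = ih S<P λ U U⊆S → hall-P U λ x ux → S⊆P x (U⊆S x ux)

  hall-rest : HallCondition (G -ᴮ NS) (P ─ S)
  hall-rest U U⊆P─S = +-cancelʳ-≤ (count S) _ _ (begin
    count U + count S                ≤⟨ count-∪-disjoint (λ x ux → proj₂ (∧-elim (U⊆P─S x ux))) ⟩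
    count (U ∪ S)                    ≤⟨ hall-P (U ∪ S) U∪S⊆P ⟩
    count (N G (U ∪ S))              ≤⟨ count-mono N-U∪S ⟩
    count (N (G -ᴮ NS) U ∪ NS)       ≤⟨ count-∪ (N (G -ᴮ NS) U) NS ⟩
    count (N (G -ᴮ NS) U) + count NS ≤⟨ +-monoʳ-≤ (count (N (G -ᴮ NS) U)) NS≤S ⟩
    count (N (G -ᴮ NS) U) + count S  ∎)
    where
    open ≤-Reasoning
    U∪S⊆P : U ∪ S ⊆ P
    U∪S⊆P x x∈U∪S with ∨-elim x∈U∪S
    ... | inj₁ ux = proj₁ (∧-not-elim (U⊆P─S x ux))
    ... | inj₂ sx = S⊆P x sx
    N-U∪S : N G (U ∪ S) ⊆ N (G -ᴮ NS) U ∪ NS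
    N-U∪S b b∈N with N⁻ {G = G} b∈N
    ... | a , a∈U∪S , gab with ∨-elim a∈U∪S
    ...   | inj₁ ua = N-⊆-∪ G NS b (N⁺ ua gab)
    ...   | inj₂ sa = ∨-introʳ (N⁺ sa gab)

  m₂ : Matching (G -ᴮ NS) (P ─ S)
  m₂ = ih (count-─< S⊆P S>0) hall-rest

hall-loose : HallBelow P → P a ≡ true → (∀ {U} → ¬ Tight G P U) → HallCondition G P → Matching G P
hall-loose {P = P} {a = a} {G = G} ih pa no-tight hall-P =
  Matching-join ⁅a⁆⊆P m₁ (λ _ → x∈⁅x⁆ b₀) m₂
  where
  ⁅a⁆⊆P : ⁅ a ⁆ ⊆ P
  ⁅a⁆⊆P x x∈⁅a⁆ = subst (λ x → P x ≡ true) (sym (x∈⁅y⁆⇒x≡y x∈⁅a⁆)) pa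

  1≤⁅a⁆ : 1 ≤ count ⁅ a ⁆
  1≤⁅a⁆ = 1≤count ⁅ a ⁆ (x∈⁅x⁆ a)

  P─a<P : count (P ─ ⁅ a ⁆) < count P
  P─a<P = count-─< ⁅a⁆⊆P 1≤⁅a⁆

  a-edge : ∃ λ c → G a c ≡ true
  a-edge =
    let c , c∈N = 0<count⇒∃ (≤-trans 1≤⁅a⁆ (hall-P ⁅ a ⁆ ⁅a⁆⊆P))
        a′ , a′∈⁅a⁆ , ga′c = N⁻ {G = G} c∈N
    in c , subst (λ x → G x c ≡ true) (x∈⁅y⁆⇒x≡y a′∈⁅a⁆) ga′c

  b₀ : Fin _
  b₀ = proj₁ a-edge

  m₁ : Matching G ⁅ a ⁆
  m₁ = record
    { partner   = λ _ → b₀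
    ; edge      = λ x∈⁅a⁆ → subst (λ x → G x b₀ ≡ true) (sym (x∈⁅y⁆⇒x≡y x∈⁅a⁆)) (proj₂ a-edge)
    ; injective = λ x∈⁅a⁆ y∈⁅a⁆ _ → ⁅⁆-unique x∈⁅a⁆ y∈⁅a⁆
    }

  hall-rest : HallCondition (G -ᴮ ⁅ b₀ ⁆) (P ─ ⁅ a ⁆)
  hall-rest U U⊆ with 0 <? count U
  ... | no  U≯0 = ≤-trans (≮⇒≥ U≯0) z≤n
  ... | yes U>0 = +-cancelʳ-≤ 1 _ _ (begin
    count U + 1                              ≡⟨ +-comm (count U) 1 ⟩
    suc (count U)                            ≤⟨ ≰⇒> (λ NU≤U → no-tight (U⊆P , U>0 , U<P , NU≤U)) ⟩
    count (N G U)                            ≤⟨ count-mono (N-⊆-∪ G ⁅ b₀ ⁆) ⟩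
    count (N (G -ᴮ ⁅ b₀ ⁆) U ∪ ⁅ b₀ ⁆)       ≤⟨ count-∪ (N (G -ᴮ ⁅ b₀ ⁆) U) ⁅ b₀ ⁆ ⟩
    count (N (G -ᴮ ⁅ b₀ ⁆) U) + count ⁅ b₀ ⁆ ≤⟨ +-monoʳ-≤ (count (N (G -ᴮ ⁅ b₀ ⁆) U)) ⁅b₀⁆≤1 ⟩
    count (N (G -ᴮ ⁅ b₀ ⁆) U) + 1            ∎)
    where
    open ≤-Reasoning
    U⊆P : U ⊆ P
    U⊆P x ux = proj₁ (∧-elim (U⊆ x ux))
    U<P : count U < count P
    U<P = ≤-<-trans (count-mono U⊆) P─a<P
    ⁅b₀⁆≤1 : count ⁅ b₀ ⁆ ≤ 1
    ⁅b₀⁆≤1 = count≤1 (⁅⁆-unique {a = b₀})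

  m₂ : Matching (G -ᴮ ⁅ b₀ ⁆) (P ─ ⁅ a ⁆)
  m₂ = ih P─a<P hall-rest

-- Halmos–Vaughan: a tight S is matched into N(S) and P ∖ S away from N(S); if no set is tight,
-- any edge ab can be fixed, since deleting a and b keeps Hall's condition.
hall-step : HallBelow P → HallCondition G P → Matching G P
hall-step {P = P} {G = G} ih hall-P with Fin.any? (λ a → P a ≟ᵇ true)
... | no P-empty = record
  { partner   = λ a → a
  ; edge      = λ pa → ⊥-elim (P-empty (_ , pa))
  ; injective = λ pa _ _ → ⊥-elim (P-empty (_ , pa))
  }
... | yes (a , pa) with tight? G P
...   | yes (_ , tight) = hall-tight ih tight hall-P
...   | no  no-tight    = hall-loose ih pa never-tight hall-P
  where
  never-tight : ∀ {U} → ¬ Tight G P U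
  never-tight {U} tight =
    no-tight (Vec.tabulate U , Tight-cong (λ x → sym (lookup∘tabulate U x)) tight)

hall-< : ∀ m → count P < m → HallCondition G P → Matching G P
hall-< (suc m) P<m = hall-step λ Q<P → hall-< m (<-≤-trans Q<P (≤-pred P<m))

hall : HallCondition G P → Matching G P
hall {P = P} = hall-< (suc (count P)) ≤-refl

injective⇒surjective : ∀ (f : Fin n → Fin n) → Injective _≡_ _≡_ f → ∀ y → ∃ λ x → f x ≡ y
injective⇒surjective {suc n} f f-injective y with Fin.any? (λ x → f x ≟ y)
... | yes hit  = hit
... | no  miss = ⊥-elim (<-irrefl refl (Fin.injective⇒≤ f′-injective))
  where
  y≢f : ∀ x → y ≢ f x
  y≢f x y≡fx = miss (x , sym y≡fx)
  f′ : Fin (suc n) → Fin n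
  f′ x = punchOut (y≢f x)
  f′-injective : Injective _≡_ _≡_ f′
  f′-injective f′x≡f′x′ = f-injective (Fin.punchOut-injective (y≢f _) (y≢f _) f′x≡f′x′)

Matching⇒OneFactor : Matching G (λ _ → true) → HasOneFactor G
Matching⇒OneFactor m =
  permutation partner inverse (proj₂ ∘ onto) (λ x → partner-injective (proj₂ (onto (partner x))))
  , λ _ → edge refl
  where
  open Matching m
  partner-injective : Injective _≡_ _≡_ partner
  partner-injective = injective refl refl
  onto : ∀ y → ∃ λ x → partner x ≡ y
  onto = injective⇒surjective partner partner-injective
  inverse : Fin _ → Fin _
  inverse y = proj₁ (onto y)

MinDegree : ℕ → BiGraph n → Set
MinDegree d G = ∀ a → d ≤ count (G a)

hall-small : MinDegree d G → 0 < count S → count S ≤ d → count S ≤ count (N G S)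
hall-small {G = G} {S = S} δ S>0 S≤d =
  let a , sa = 0<count⇒∃ {f = S} S>0 in
  ≤-trans S≤d (≤-trans (δ a) (count-mono {f = G a} {g = N G S} λ _ → N⁺ sa))

hall-large : ∀ {n} {G : BiGraph n} {S} →
             MinDegree d (transpose G) → n < count S + d → count S ≤ count (N G S)
hall-large {d} {n} {G} {S} δᵀ large =
  ≤-trans (count-mono {f = S} {g = λ _ → true} λ _ _ → refl)
          (count-mono {f = λ _ → true} {g = N G S} λ b _ → everyone b)
  where
  open ≤-Reasoning
  everyone : ∀ b → N G S b ≡ true
  everyone b =
    let a , sa , gab = count<⇒∃─ {g = ∁ (transpose G b)} (+-cancelʳ-< d _ _ (begin-strict
          count (∁ (transpose G b)) + d                     ≤⟨ +-monoʳ-≤ _ (δᵀ b) ⟩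
          count (∁ (transpose G b)) + count (transpose G b) ≡⟨ +-comm (count (∁ (transpose G b))) _ ⟩
          count (transpose G b) + count (∁ (transpose G b)) ≡⟨ count-∁ (transpose G b) ⟩
          n                                                 <⟨ large ⟩
          count S + d                                       ∎))
    in N⁺ sa (not≡false gab)

-- Bigraphs, degrees and edge sets given by vectors

∣tabulate∣≡count : ∀ (f : Fin n → Bool) → ∣ Vec.tabulate f ∣ ≡ count f
∣tabulate∣≡count {zero}  f = refl
∣tabulate∣≡count {suc n} f =
  trans (∣∷∣ (f zero)) (cong (bit (f zero) +_) (∣tabulate∣≡count (f ∘ suc)))
  where
  ∣∷∣ : ∀ p → ∣ p Vec.∷ Vec.tabulate (f ∘ suc) ∣ ≡ bit p + ∣ Vec.tabulate (f ∘ suc) ∣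
  ∣∷∣ true  = refl
  ∣∷∣ false = refl

∣∣≡count : ∀ (X : Subset n) → ∣ X ∣ ≡ count (Vec.lookup X)
∣∣≡count X = trans (cong ∣_∣ (sym (tabulate∘lookup X))) (∣tabulate∣≡count (Vec.lookup X))

opaque
  unfolding N

  lookup-nbr : ∀ (G : BiGraph n) (X : Subset n) b → Vec.lookup (nbr G X) b ≡ N G (Vec.lookup X) b
  lookup-nbr G X b = lookup∘tabulate _ b

∣nbr∣≡count : ∀ (G : BiGraph n) X → ∣ nbr G X ∣ ≡ count (N G (Vec.lookup X))
∣nbr∣≡count G X = trans (∣∣≡count (nbr G X)) (count-cong (lookup-nbr G X))

∈compl-nbr : ∀ (G : BiGraph n) X → b ∈ compl (nbr G X) → ∁ (N G (Vec.lookup X)) b ≡ true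
∈compl-nbr {b = b} G X b∈ =
  trans (sym (trans (lookup-map b not (nbr G X)) (cong not (lookup-nbr G X b)))) ([]=⇒lookup b∈)

IsBigraph⇒MinDegree : IsBigraph n d G → MinDegree d G × MinDegree d (transpose G)
IsBigraph⇒MinDegree {G = G} (δA , δB) =
  (λ a → subst (_ ≤_) (∣tabulate∣≡count (G a)) (δA a)) ,
  (λ b → subst (_ ≤_) (∣tabulate∣≡count (transpose G b)) (δB b))

AtMostOneEdge : BiGraph n → Set
AtMostOneEdge E = ∀ {a b a′ b′} → E a b ≡ true → E a′ b′ ≡ true → a ≡ a′ × b ≡ b′

sum-allFin : ∀ (g : Fin n → ℕ) → sum (map g (allFin n)) ≡ sum (tabulate g)
sum-allFin g = cong sum (map-tabulate (λ x → x) g)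

≤sum : ∀ (g : Fin n → ℕ) x → g x ≤ sum (tabulate g)
≤sum g zero    = m≤m+n _ _
≤sum g (suc x) = ≤-trans (≤sum (g ∘ suc) x) (m≤n+m _ (g zero))

sum≤1⇒unique : ∀ (g : Fin n → ℕ) → sum (tabulate g) ≤ 1 → 0 < g x → 0 < g y → x ≡ y
sum≤1⇒unique {x = zero}  {y = zero}  _ _  _  _  = refl
sum≤1⇒unique {x = zero}  {y = suc y} g ≤1 gx gy =
  ⊥-elim (≤⇒≯ ≤1 (+-mono-≤ gx (≤-trans gy (≤sum (g ∘ suc) y))))
sum≤1⇒unique {x = suc x} {y = zero}  g ≤1 gx gy =
  ⊥-elim (≤⇒≯ ≤1 (+-mono-≤ gy (≤-trans gx (≤sum (g ∘ suc) x))))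
sum≤1⇒unique {x = suc x} {y = suc y} g ≤1 gx gy =
  cong suc (sum≤1⇒unique (g ∘ suc) (≤-trans (m≤n+m _ (g zero)) ≤1) gx gy)

numEdges≤1⇒AtMostOneEdge : numEdges E ≤ 1 → AtMostOneEdge E
numEdges≤1⇒AtMostOneEdge {E = E} ≤1 {a} {b} {a′} {b′} eab ea′b′ = a≡a′ , b≡b′
  where
  degrees≤1 : sum (tabulate (degA E)) ≤ 1
  degrees≤1 = subst (_≤ 1) (sum-allFin (degA E)) ≤1
  0<degA : E x y ≡ true → 0 < degA E x
  0<degA {x = x} exy = subst (0 <_) (sym (∣tabulate∣≡count (E x))) (1≤count (E x) exy)
  a≡a′ : a ≡ a′
  a≡a′ = sum≤1⇒unique (degA E) degrees≤1 (0<degA eab) (0<degA ea′b′)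
  b≡b′ : b ≡ b′
  b≡b′ = count≤1⇒unique row≤1 eab (subst (λ z → E z b′ ≡ true) (sym a≡a′) ea′b′)
    where
    row≤1 : count (E a) ≤ 1
    row≤1 = subst (_≤ 1) (∣tabulate∣≡count (E a)) (≤-trans (≤sum (degA E) a) degrees≤1)

Retains : (G H M₃ M₄ : BiGraph n) → Set
Retains G H M₃ M₄ = ∀ {a b} → G a b ≡ false → H a b ≡ false ⊎ M₃ a b ≡ true ⊎ M₄ a b ≡ true

Retains-intro : (∀ {a b} → H a b ≡ true → M₃ a b ≡ false → M₄ a b ≡ false → G a b ≡ true) →
                Retains G H M₃ M₄
Retains-intro {H = H} {M₃ = M₃} {M₄ = M₄} kept {a} {b} gab
  with true-or-false (H a b) | true-or-false (M₃ a b) | true-or-false (M₄ a b)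
... | inj₂ hab | _       | _       = inj₁ hab
... | inj₁ _   | inj₁ m₃ | _       = inj₂ (inj₁ m₃)
... | inj₁ _   | inj₂ _  | inj₁ m₄ = inj₂ (inj₂ m₄)
... | inj₁ hab | inj₂ m₃ | inj₂ m₄ = ⊥-elim (not-¬ (kept hab m₃ m₄) gab)

-- Nearly complete blocks

AtMostOneNonEdge : BiGraph n → (P Q : Fin n → Bool) → Set
AtMostOneNonEdge H P Q = ∀ {a b a′ b′} → P a ≡ true → Q b ≡ true → P a′ ≡ true → Q b′ ≡ true →
                         H a b ≡ false → H a′ b′ ≡ false → a ≡ a′ × b ≡ b′

AtMostOneEdge-transpose : AtMostOneEdge E → AtMostOneEdge (transpose E)
AtMostOneEdge-transpose one eab ea′b′ = swap (one eab ea′b′)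

AtMostOneNonEdge-transpose : AtMostOneNonEdge H P Q → AtMostOneNonEdge (transpose H) Q P
AtMostOneNonEdge-transpose one qb pa qb′ pa′ hab ha′b′ = swap (one pa qb pa′ qb′ hab ha′b′)

AtMostOneNonEdge-mono : U ⊆ P → V ⊆ Q → AtMostOneNonEdge H P Q → AtMostOneNonEdge H U V
AtMostOneNonEdge-mono U⊆P V⊆Q one ua vb ua′ vb′ =
  one (U⊆P _ ua) (V⊆Q _ vb) (U⊆P _ ua′) (V⊆Q _ vb′)

uncovered : AtMostOneEdge E → 2 ≤ count P → ∃ λ a → P a ≡ true × ∀ b → E a b ≡ false
uncovered {E = E} {P = P} one 2≤P =
  let a , pa , a-uncovered = count<⇒∃─ {g = covered} (<-≤-trans (s≤s covered≤1) 2≤P)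
  in a , pa , λ b → N-∁ {S = λ _ → true} {G = transpose E} refl a-uncovered
  where
  covered : Fin _ → Bool
  covered = N (transpose E) (λ _ → true)
  covered-unique : covered a ≡ true → covered a′ ≡ true → a ≡ a′
  covered-unique a∈ a′∈ =
    let _ , _ , eab = N⁻ a∈ ; _ , _ , ea′b′ = N⁻ a′∈ in proj₁ (one eab ea′b′)
  covered≤1 : count covered ≤ 1
  covered≤1 = count≤1 {f = covered} covered-unique

count-─≤ : count Q ≤ count f → f ─ e ⊆ Q → count (Q ─ f) ≤ count e
count-─≤ {Q = Q} {f = f} {e = e} Q≤f f─e⊆Q = +-cancelˡ-≤ (count (Q ∩ f)) _ _ (begin
  count (Q ∩ f) + count (Q ─ f) ≡⟨ count-split Q f ⟨
  count Q                       ≤⟨ Q≤f ⟩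
  count f                       ≡⟨ count-split f e ⟩
  count (f ∩ e) + count (f ─ e) ≤⟨ +-mono-≤ (count-mono f∩e⊆e) (count-mono f─e⊆Q∩f) ⟩
  count e + count (Q ∩ f)       ≡⟨ +-comm (count e) _ ⟩
  count (Q ∩ f) + count e       ∎)
  where
  open ≤-Reasoning
  f∩e⊆e : f ∩ e ⊆ e
  f∩e⊆e _ = proj₂ ∘ ∧-elim
  f─e⊆Q∩f : f ─ e ⊆ Q ∩ f
  f─e⊆Q∩f x x∈f─e = ∧-intro (f─e⊆Q x x∈f─e) (proj₁ (∧-elim x∈f─e))

nonEdges-unique : AtMostOneEdge E → (∀ {a} → P a ≡ true → count Q ≤ count (F a)) →
                  (∀ {a} → P a ≡ true → F a ─ E a ⊆ Q) → AtMostOneNonEdge F P Q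
nonEdges-unique {E = E} {P = P} {Q = Q} {F = F} one deg closed {a} {b} {a′} {b′}
                pa qb pa′ qb′ fab fa′b′ = a≡a′ , b≡b′
  where
  missing≤incident : P x ≡ true → count (Q ─ F x) ≤ count (E x)
  missing≤incident px = count-─≤ (deg px) (closed px)
  incident : P x ≡ true → Q y ≡ true → F x y ≡ false → ∃ λ z → E x z ≡ true
  incident {x = x} px qy fxy =
    0<count⇒∃ (≤-trans (1≤count (Q ─ F x) (∧-not-intro qy fxy)) (missing≤incident px))
  a≡a′ : a ≡ a′
  a≡a′ = proj₁ (one (proj₂ (incident pa qb fab)) (proj₂ (incident pa′ qb′ fa′b′)))
  b≡b′ : b ≡ b′
  b≡b′ = count≤1⇒unique (≤-trans (missing≤incident pa) (count≤1 {f = E a} (proj₂ ∘₂ one)))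
           (∧-not-intro qb fab)
           (∧-not-intro qb′ (subst (λ z → F z b′ ≡ false) (sym a≡a′) fa′b′))

count≤2+missing : count f ≤ 1 → count g ≤ 1 →
                  (∀ x → V x ≡ true → e x ≡ false ⊎ f x ≡ true ⊎ g x ≡ true) →
                  count V ≤ 2 + count (V ─ e)
count≤2+missing {f = f} {g = g} {V = V} {e = e} f≤1 g≤1 cover = begin
  count V                       ≤⟨ count-mono V⊆ ⟩
  count ((f ∪ g) ∪ (V ─ e))     ≤⟨ count-∪ (f ∪ g) (V ─ e) ⟩
  count (f ∪ g) + count (V ─ e) ≤⟨ +-monoˡ-≤ (count (V ─ e)) f∪g≤2 ⟩
  2 + count (V ─ e)             ∎
  where
  open ≤-Reasoning
  f∪g≤2 : count (f ∪ g) ≤ 2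
  f∪g≤2 = ≤-trans (count-∪ f g) (+-mono-≤ f≤1 g≤1)
  V⊆ : V ⊆ (f ∪ g) ∪ (V ─ e)
  V⊆ x vx with cover x vx
  ... | inj₁ ex        = ∨-introʳ (∧-not-intro vx ex)
  ... | inj₂ (inj₁ fx) = ∨-introˡ (∨-introˡ fx)
  ... | inj₂ (inj₂ gx) = ∨-introˡ (∨-introʳ {p = f x} gx)

edgeless-one-side : (∀ {a x y} → M₃ a x ≡ true → M₃ a y ≡ true → x ≡ y) →
                    (∀ {a x y} → M₄ a x ≡ true → M₄ a y ≡ true → x ≡ y) →
                    Retains G H M₃ M₄ → (∀ {a b} → U a ≡ true → V b ≡ true → G a b ≡ false) →
                    AtMostOneNonEdge H U V → 0 < count U →
                    count V ≤ 3 × (3 ≤ count V → count U ≤ 1)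
edgeless-one-side {M₃ = M₃} {M₄ = M₄} {H = H} {U = U} {V = V}
                  M₃-rows M₄-rows retains no-edge one-nonEdge U>0 = V≤3 , V≥3⇒U≤1
  where
  V≤2+missing : U a ≡ true → count V ≤ 2 + count (V ─ H a)
  V≤2+missing {a} ua =
    count≤2+missing {V = V} {e = H a} (count≤1 {f = M₃ a} M₃-rows) (count≤1 {f = M₄ a} M₄-rows)
      λ _ vb → retains (no-edge ua vb)
  missing≤1 : U a ≡ true → count (V ─ H a) ≤ 1
  missing≤1 {a} ua = count≤1 {f = V ─ H a} λ h h′ →
    let vb , hab = ∧-not-elim h ; vb′ , hab′ = ∧-not-elim h′
    in proj₂ (one-nonEdge ua vb ua vb′ hab hab′)
  V≤3 : count V ≤ 3
  V≤3 = let _ , ua = 0<count⇒∃ {f = U} U>0 in ≤-trans (V≤2+missing ua) (+-monoʳ-≤ 2 (missing≤1 ua))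
  missing-in-row : U a ≡ true → 3 ≤ count V → ∃ λ b → V b ≡ true × H a b ≡ false
  missing-in-row ua 3≤V =
    let b , missing = 0<count⇒∃ (+-cancelˡ-≤ 2 1 _ (≤-trans 3≤V (V≤2+missing ua)))
    in b , ∧-not-elim missing
  V≥3⇒U≤1 : 3 ≤ count V → count U ≤ 1
  V≥3⇒U≤1 3≤V = count≤1 {f = U} λ ua ua′ →
    let _ , vb , hab = missing-in-row ua 3≤V ; _ , vb′ , ha′b′ = missing-in-row ua′ 3≤V
    in proj₁ (one-nonEdge ua vb ua′ vb′ hab ha′b′)

≤4 : ∀ {u v} → u ≤ 3 → v ≤ 3 → (3 ≤ v → u ≤ 1) → (3 ≤ u → v ≤ 1) → u + v ≤ 4
≤4 {u} {v} u≤3 v≤3 large-v large-u with 3 ≤? u | 3 ≤? v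
... | yes 3≤u | _       = +-mono-≤ u≤3 (large-u 3≤u)
... | no  _   | yes 3≤v = +-mono-≤ (large-v 3≤v) v≤3
... | no  u<3 | no  v<3 = +-mono-≤ (≤-pred (≰⇒> u<3)) (≤-pred (≰⇒> v<3))

edgeless⇒≤4 : IsMatching M₃ → IsMatching M₄ → Retains G H M₃ M₄ →
              (∀ {a b} → U a ≡ true → V b ≡ true → G a b ≡ false) → AtMostOneNonEdge H U V →
              0 < count U → 0 < count V → count U + count V ≤ 4
edgeless⇒≤4 {M₃ = M₃} {M₄ = M₄} {G = G} {H = H} {U = U} {V = V}
            (M₃-rows , M₃-cols) (M₄-rows , M₄-cols) retains no-edge one-nonEdge U>0 V>0 =
  ≤4 (proj₁ cols) (proj₁ rows) (proj₂ rows) (proj₂ cols)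
  where
  rows : count V ≤ 3 × (3 ≤ count V → count U ≤ 1)
  rows = edgeless-one-side (M₃-rows _ _ _) (M₄-rows _ _ _) retains no-edge one-nonEdge U>0
  cols : count U ≤ 3 × (3 ≤ count U → count V ≤ 1)
  cols = edgeless-one-side {M₃ = transpose M₃} {M₄ = transpose M₄}
                           {G = transpose G} {H = transpose H}
           (M₃-cols _ _ _) (M₄-cols _ _ _) retains (λ vb ua → no-edge ua vb)
           (AtMostOneNonEdge-transpose one-nonEdge) V>0

two-edges-escape : a ≢ a′ → b ≢ b′ → P a ≡ true → P a′ ≡ true → Q b ≡ true → Q b′ ≡ true →
                   G a b ≡ true → G a′ b′ ≡ true → ∀ S → 2 ≤ count (P ─ S) + count (Q ∩ N G S)
two-edges-escape {a = a} {a′ = a′} {P = P} {Q = Q} {G = G} a≢a′ b≢b′ pa pa′ qb qb′ gab ga′b′ S =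
  by-cases (true-or-false (S a)) (true-or-false (S a′))
  where
  reached : S x ≡ true → G x y ≡ true → Q y ≡ true → (Q ∩ N G S) y ≡ true
  reached sx gxy qy = ∧-intro qy (N⁺ sx gxy)
  by-cases : S a ≡ true ⊎ S a ≡ false → S a′ ≡ true ⊎ S a′ ≡ false →
             2 ≤ count (P ─ S) + count (Q ∩ N G S)
  by-cases (inj₁ sa) (inj₁ sa′) =
    ≤-trans (2≤count (Q ∩ N G S) (reached sa gab qb) (reached sa′ ga′b′ qb′) b≢b′) (m≤n+m _ _)
  by-cases (inj₁ sa) (inj₂ sa′) =
    +-mono-≤ (1≤count (P ─ S) (∧-not-intro pa′ sa′)) (1≤count (Q ∩ N G S) (reached sa gab qb))
  by-cases (inj₂ sa) (inj₁ sa′) =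
    +-mono-≤ (1≤count (P ─ S) (∧-not-intro pa sa)) (1≤count (Q ∩ N G S) (reached sa′ ga′b′ qb′))
  by-cases (inj₂ sa) (inj₂ sa′) =
    ≤-trans (2≤count (P ─ S) (∧-not-intro pa sa) (∧-not-intro pa′ sa′) a≢a′) (m≤m+n _ _)

-- Counting with 2d + 2 vertices on each side

sum≡d+d⇒both≡d : ∀ {d s t} → s + t ≡ d + d → d ≤ s → d ≤ t → s ≡ d × t ≡ d
sum≡d+d⇒both≡d {d} {s} {t} s+t≡d+d d≤s d≤t = ≤-antisym s≤d d≤s , ≤-antisym t≤d d≤t
  where
  s≤d : s ≤ d
  s≤d = +-cancelʳ-≤ d s d (≤-trans (+-monoʳ-≤ s d≤t) (≤-reflexive s+t≡d+d))
  t≤d : t ≤ d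
  t≤d = +-cancelˡ-≤ d t d (≤-trans (+-monoˡ-≤ t d≤s) (≤-reflexive s+t≡d+d))

s+r≤1+d : ∀ {d s r} → 3 ≤ d → s ≤ suc d → (0 < r → s + r ≤ 4) → s + r ≤ suc d
s+r≤1+d {r = zero}  _   s≤1+d _     = subst (_≤ _) (sym (+-identityʳ _)) s≤1+d
s+r≤1+d {r = suc _} 3≤d _     small = ≤-trans (small (s≤s z≤n)) (s≤s 3≤d)

-- In the application s = |S ∩ X|, t = |S ∖ X| and xs = |X ∖ S|, while p + r = |N| and
-- q + r′ = |B ∖ N| are split by membership in N_{H′}(S).
middle-count : ∀ {d s t p q r r′ xs} → 3 ≤ d → d < s + t → s + t ≤ 2 + d → t ≤ d →
               p + r ≡ d → q + r′ ≡ 2 + d → s + xs ≡ 2 + d → 2 ≤ xs + q →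
               (0 < s → 0 < r → s + r ≤ 4) → (0 < t → 0 < r′ → t + r′ ≤ 4) → s + t ≤ p + q
middle-count {d} {s} {zero} {p} {q} {zero} {xs = xs} _ _ _ _ p+0≡d _ s+xs≡ 2≤xs+q _ _ = begin
  s + 0     ≡⟨ +-identityʳ s ⟩
  s         ≤⟨ +-cancelʳ-≤ 2 s (d + q) (begin
    s + 2        ≤⟨ +-monoʳ-≤ s 2≤xs+q ⟩
    s + (xs + q) ≡⟨ +-assoc s xs q ⟨
    s + xs + q   ≡⟨ cong (_+ q) s+xs≡ ⟩
    2 + (d + q)  ≡⟨ +-comm 2 (d + q) ⟩
    d + q + 2    ∎) ⟩
  d + q     ≡⟨ cong (_+ q) p+0≡d ⟨
  p + 0 + q ≡⟨ cong (_+ q) (+-identityʳ p) ⟩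
  p + q     ∎
  where open ≤-Reasoning
middle-count {d} {s} {zero} {r = suc _} 3≤d d<s+0 _ _ _ _ _ _ small _ =
  ⊥-elim (≤⇒≯ (small (≤-trans (s≤s z≤n) 4≤s) (s≤s z≤n)) (≤-<-trans 4≤s (m<m+n s (s≤s z≤n))))
  where
  4≤s : 4 ≤ s
  4≤s = ≤-trans (s≤s 3≤d) (subst (suc d ≤_) (+-identityʳ s) d<s+0)
middle-count {d} {s} {suc t} {p} {q} {r} {r′}
             3≤d d<s+t s+t≤2+d t≤d p+r≡d q+r′≡2+d _ _ small small′ =
  +-cancelʳ-≤ (r + r′) (s + suc t) (p + q) (begin
    s + suc t + (r + r′) ≡⟨ interchange s (suc t) r r′ ⟩
    s + r + (suc t + r′) ≤⟨ +-mono-≤ (s+r≤1+d 3≤d s≤1+d (small 0<s))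
                                     (s+r≤1+d 3≤d (m≤n⇒m≤1+n t≤d) (small′ (s≤s z≤n))) ⟩
    suc d + suc d        ≡⟨ +-suc d (suc d) ⟨
    d + (2 + d)          ≡⟨ cong₂ _+_ p+r≡d q+r′≡2+d ⟨
    p + r + (q + r′)     ≡⟨ interchange p r q r′ ⟩
    p + q + (r + r′)     ∎)
  where
  open ≤-Reasoning
  s≤1+d : s ≤ suc d
  s≤1+d = m+n≤o⇒m≤o s (≤-pred (subst (_≤ 2 + d) (+-suc s t) s+t≤2+d))
  0<s : 0 < s
  0<s = +-cancelʳ-< (suc t) 0 s (≤-<-trans t≤d d<s+t)

module DeficiencyTwo
  {n d : ℕ} (3≤d : 3 ≤ d) (n≡2+d+d : n ≡ 2 + (d + d))
  (H H′ M₃ M₄ Ẽ : BiGraph n) (X : Fin n → Bool)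
  (δH : MinDegree d H) (δHᵀ : MinDegree d (transpose H))
  (δH′ : MinDegree d H′) (δH′ᵀ : MinDegree d (transpose H′))
  (M₃-matching : IsMatching M₃) (M₄-matching : IsMatching M₄) (retains : Retains H′ H M₃ M₄)
  (Ẽ-one : AtMostOneEdge Ẽ)
  (deficiency : count X ≡ 2 + count (N (H -E Ẽ) X))
  (escape : ∀ S → 2 ≤ count (X ─ S) + count (∁ (N (H -E Ẽ) X) ∩ N H′ S))
  where

  NX : Fin n → Bool
  NX = N (H -E Ẽ) X

  ∁NX-closed : ∁ NX b ≡ true → (H -E Ẽ) a b ≡ true → ∁ X a ≡ true
  ∁NX-closed b∉NX e = cong not (¬-not λ xa → not-¬ (N⁺ xa e) (not≡true b∉NX))

  2≤X : 2 ≤ count X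
  2≤X = subst (2 ≤_) (sym deficiency) (m≤m+n 2 _)

  2≤∁NX : 2 ≤ count (∁ NX)
  2≤∁NX = +-cancelˡ-≤ (count NX) 2 _ (begin
    count NX + 2            ≡⟨ +-comm (count NX) 2 ⟩
    2 + count NX            ≡⟨ deficiency ⟨
    count X                 ≤⟨ m≤m+n _ _ ⟩
    count X + count (∁ X)   ≡⟨ count-∁ X ⟩
    n                       ≡⟨ count-∁ NX ⟨
    count NX + count (∁ NX) ∎)
    where open ≤-Reasoning

  d≤NX : d ≤ count NX
  d≤NX = let x , xx , free = uncovered Ẽ-one 2≤X in
    ≤-trans (δH x) (count-mono {f = H x} {g = NX} λ b hxb → N⁺ xx (∧-not-intro hxb (free b)))

  d≤∁X : d ≤ count (∁ X)
  d≤∁X = let b , b∉NX , free = uncovered (AtMostOneEdge-transpose Ẽ-one) 2≤∁NX in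
    ≤-trans (δHᵀ b) (count-mono {f = transpose H b} {g = ∁ X}
                                λ a hab → ∁NX-closed b∉NX (∧-not-intro hab (free a)))

  NX+∁X : count NX + count (∁ X) ≡ d + d
  NX+∁X = +-cancelˡ-≡ 2 _ _ (begin
    2 + (count NX + count (∁ X)) ≡⟨ cong (_+ count (∁ X)) deficiency ⟨
    count X + count (∁ X)        ≡⟨ count-∁ X ⟩
    n                            ≡⟨ n≡2+d+d ⟩
    2 + (d + d)                  ∎)
    where open ≡-Reasoning

  count-NX : count NX ≡ d
  count-NX = proj₁ (sum≡d+d⇒both≡d NX+∁X d≤NX d≤∁X)

  count-∁X : count (∁ X) ≡ d
  count-∁X = proj₂ (sum≡d+d⇒both≡d NX+∁X d≤NX d≤∁X)

  count-X : count X ≡ 2 + d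
  count-X = trans deficiency (cong (2 +_) count-NX)

  count-∁NX : count (∁ NX) ≡ 2 + d
  count-∁NX = +-cancelˡ-≡ d _ _ (begin
    d + count (∁ NX)        ≡⟨ cong (_+ count (∁ NX)) count-NX ⟨
    count NX + count (∁ NX) ≡⟨ count-∁ NX ⟩
    n                       ≡⟨ n≡2+d+d ⟩
    2 + d + d               ≡⟨ +-comm (2 + d) d ⟩
    d + (2 + d)             ∎)
    where open ≡-Reasoning

  X×NX-nearly-complete : AtMostOneNonEdge H X NX
  X×NX-nearly-complete = nonEdges-unique Ẽ-one
    (λ {a} _ → subst (_≤ count (H a)) (sym count-NX) (δH a))
    (λ xa b e → N⁺ xa e)

  ∁X×∁NX-nearly-complete : AtMostOneNonEdge H (∁ X) (∁ NX)
  ∁X×∁NX-nearly-complete = AtMostOneNonEdge-transpose {H = transpose H}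
    (nonEdges-unique (AtMostOneEdge-transpose Ẽ-one)
      (λ {b} _ → subst (_≤ count (transpose H b)) (sym count-∁X) (δHᵀ b))
      (λ b∉NX a e → ∁NX-closed b∉NX e))

  hall-middle : d < count S → count S ≤ 2 + d → count S ≤ count (N H′ S)
  hall-middle {S} d<S S≤2+d = begin
    count S                           ≡⟨ count-split S X ⟩
    count (S ∩ X) + count (S ─ X)     ≤⟨ middle-count 3≤d (subst (d <_) (count-split S X) d<S)
                                           (subst (_≤ 2 + d) (count-split S X) S≤2+d) t≤d p+r≡d q+r′≡2+d
                                           s+xs≡2+d (escape S) X-block ∁X-block ⟩
    count (NX ∩ T) + count (∁ NX ∩ T) ≡⟨ cong₂ _+_ (count-∩-comm NX T) (count-∩-comm (∁ NX) T) ⟩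
    count (T ∩ NX) + count (T ─ NX)   ≡⟨ count-split T NX ⟨
    count T                           ∎
    where
    open ≤-Reasoning
    T : Fin n → Bool
    T = N H′ S
    t≤d : count (S ─ X) ≤ d
    t≤d = ≤-trans (count-mono {f = S ─ X} {g = ∁ X} λ _ → proj₂ ∘ ∧-elim) (≤-reflexive count-∁X)
    p+r≡d : count (NX ∩ T) + count (NX ─ T) ≡ d
    p+r≡d = trans (sym (count-split NX T)) count-NX
    q+r′≡2+d : count (∁ NX ∩ T) + count (∁ NX ─ T) ≡ 2 + d
    q+r′≡2+d = trans (sym (count-split (∁ NX) T)) count-∁NX
    s+xs≡2+d : count (S ∩ X) + count (X ─ S) ≡ 2 + d
    s+xs≡2+d =
      trans (cong (_+ count (X ─ S)) (count-∩-comm S X)) (trans (sym (count-split X S)) count-X)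
    X-block : 0 < count (S ∩ X) → 0 < count (NX ─ T) → count (S ∩ X) + count (NX ─ T) ≤ 4
    X-block = edgeless⇒≤4 M₃-matching M₄-matching retains
      (λ a∈ b∈ → N-∁ (proj₁ (∧-elim a∈)) (proj₂ (∧-not-elim b∈)))
      (AtMostOneNonEdge-mono (λ _ → proj₂ ∘ ∧-elim) (λ _ → proj₁ ∘ ∧-elim) X×NX-nearly-complete)
    ∁X-block : 0 < count (S ─ X) → 0 < count (∁ NX ─ T) → count (S ─ X) + count (∁ NX ─ T) ≤ 4
    ∁X-block = edgeless⇒≤4 M₃-matching M₄-matching retains
      (λ a∈ b∈ → N-∁ (proj₁ (∧-elim a∈)) (proj₂ (∧-not-elim b∈)))
      (AtMostOneNonEdge-mono (λ _ → proj₂ ∘ ∧-elim) (λ _ → proj₁ ∘ ∧-elim) ∁X×∁NX-nearly-complete)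

  hall-condition : HallCondition H′ (λ _ → true)
  hall-condition S _ with 0 <? count S | count S ≤? d | 3 + d ≤? count S
  ... | no  S≯0 | _       | _         = ≤-trans (≮⇒≥ S≯0) z≤n
  ... | yes S>0 | yes S≤d | _         = hall-small δH′ S>0 S≤d
  ... | yes _   | no  _   | yes large =
    hall-large δH′ᵀ (subst (_< count S + d) (sym n≡2+d+d) (+-monoˡ-≤ d large))
  ... | yes _   | no  S≰d | no  S≱3+d = hall-middle (≰⇒> S≰d) (≤-pred (≰⇒> S≱3+d))

lemma24 : (k : ℕ) → 4 ≤ k →
    (H : BiGraph (2 * k)) → IsBigraph (2 * k) (k ∸ 1) H →
    (X : Subset (2 * k)) → (Ẽ : EdgeSet (2 * k)) → Ẽ ⊆E H → numEdges Ẽ ≤ 1 →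
    ∣ X ∣ ≡ 2 + ∣ nbr (H -E Ẽ) X ∣ →
    (H′ : BiGraph (2 * k)) → IsBigraph (2 * k) (k ∸ 1) H′ → FormedBy H H′ →
    Matching2 H′ X (compl (nbr (H -E Ẽ) X)) →
    HasOneFactor H′
lemma24 (suc d) (s≤s 3≤d) H H-bigraph X Ẽ _ Ẽ≤1 deficiency H′ H′-bigraph
  (_ , _ , M₃ , M₄ , _ , _ , M₃-matching , M₄-matching , _ , from-H)
  (a₁ , b₁ , a₂ , b₂ , a₁≢a₂ , b₁≢b₂ , a₁∈X , a₂∈X , b₁∉N , b₂∉N , e₁ , e₂) =
  Matching⇒OneFactor (hall (DeficiencyTwo.hall-condition 3≤d 2n≡2+d+d H H′ M₃ M₄ Ẽ (Vec.lookup X)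
    (proj₁ δH) (proj₂ δH) (proj₁ δH′) (proj₂ δH′)
    M₃-matching M₄-matching (Retains-intro λ {a} {b} h m₃ m₄ → from-H a b (inj₁ (h , m₃ , m₄)))
    (numEdges≤1⇒AtMostOneEdge {E = Ẽ} Ẽ≤1)
    (trans (sym (∣∣≡count X)) (trans deficiency (cong (2 +_) (∣nbr∣≡count (H -E Ẽ) X))))
    (two-edges-escape a₁≢a₂ b₁≢b₂ ([]=⇒lookup a₁∈X) ([]=⇒lookup a₂∈X)
      (∈compl-nbr (H -E Ẽ) X b₁∉N) (∈compl-nbr (H -E Ẽ) X b₂∉N) e₁ e₂)))
  where
  δH : MinDegree d H × MinDegree d (transpose H)
  δH = IsBigraph⇒MinDegree {G = H} H-bigraph
  δH′ : MinDegree d H′ × MinDegree d (transpose H′)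
  δH′ = IsBigraph⇒MinDegree {G = H′} H′-bigraph
  2n≡2+d+d : 2 * suc d ≡ 2 + (d + d)
  2n≡2+d+d = trans (*-suc 2 d) (cong (λ m → 2 + (d + m)) (+-identityʳ d))
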